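{- Let $n$ be a nonnegative integer. Suppose there exist a nonnegative integer $B$ and integers $x,y,z$ such that $3\mid n+B$ and $$\frac23(n+B)+B-5B^2=x^2+y^2+z^2+\frac{(x+y+z)^2}{2}\le B^2.$$ Then there exist nonnegative integers $x_0,y_0,z_0,w_0$ with $n=p_5(x_0)+p_5(y_0)+p_5(z_0)+2p_5(w_0)$, where $p_5(m)=m(3m-1)/2$.
   Context: The pentagonal numbers are $p_5(m)=m(3m-1)/2$ for $m\in\{0,1,2,\ldots\}$. -}

module Defs where

open import Data.Nat using (ℕ; _*_; _∸_; _/_)

-- pentagonal numbers p₅(m) = m(3m-1)/2  (m(3m-1) is always even, and for m = 0 gives 0)
p5 : ℕ → ℕ
p5 m = (m * (3 * m ∸ 1)) / 2

module Submission where

-- The equation makes 3(x+y+z)² even, so x+y+z = 2t.  With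
-- P(m) = 3m² − m = 2 p₅(m), expanding around B gives
-- P(B+x) + P(B+y) + P(B+z) + 2 P(B−t) = 2n, and the inequality bounds x², y², z², t²
-- by B², so the four arguments are natural numbers.

open import Defs
open import Data.Nat using (ℕ)
open import Data.Nat.Divisibility using (_∣_)
open import Data.Integer using (ℤ; +_; _+_; _-_; _*_; _≤_)
open import Data.Product using (Σ; _×_; ∃-syntax)
open import Relation.Binary.PropositionalEquality using (_≡_)

open import Data.Empty using (⊥-elim)
open import Data.Product using (_,_)
open import Data.Nat as ℕ using (zero; suc)
import Data.Nat.Properties as ℕ
open import Data.Nat.DivMod using (m*n/n≡m)
import Data.Nat.Tactic.RingSolver as ℕ-Ring
open import Data.Integer using (0ℤ; -_; -[1+_]; ∣_∣; +≤+; Positive; nonNegative)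
import Data.Integer.Properties as ℤ
open import Data.Integer.DivMod using (_%ℕ_; _/ℕ_; a≡a%ℕn+[a/ℕn]*n; n%ℕd<d)
import Data.Integer.Tactic.RingSolver as ℤ-Ring
open import Relation.Nullary using (yes; no)
open import Relation.Binary.PropositionalEquality
  using (_≢_; refl; sym; trans; cong; cong₂; subst; module ≡-Reasoning)

open ≡-Reasoning

pentagonal : ℕ → ℕ
pentagonal zero    = 0
pentagonal (suc k) = pentagonal k ℕ.+ (3 ℕ.* k ℕ.+ 1)

2*pentagonal[n]+n≡3*n*n : ∀ n → 2 ℕ.* pentagonal n ℕ.+ n ≡ 3 ℕ.* (n ℕ.* n)
2*pentagonal[n]+n≡3*n*n zero    = refl
2*pentagonal[n]+n≡3*n*n (suc k) = begin
  2 ℕ.* (pentagonal k ℕ.+ (3 ℕ.* k ℕ.+ 1)) ℕ.+ suc k ≡⟨ regroup (pentagonal k) k ⟩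
  (2 ℕ.* pentagonal k ℕ.+ k) ℕ.+ (6 ℕ.* k ℕ.+ 3)    ≡⟨ cong (ℕ._+ (6 ℕ.* k ℕ.+ 3)) (2*pentagonal[n]+n≡3*n*n k) ⟩
  3 ℕ.* (k ℕ.* k) ℕ.+ (6 ℕ.* k ℕ.+ 3)               ≡⟨ square-suc k ⟩
  3 ℕ.* (suc k ℕ.* suc k)                           ∎
  where
  regroup : ∀ p k → 2 ℕ.* (p ℕ.+ (3 ℕ.* k ℕ.+ 1)) ℕ.+ suc k ≡ (2 ℕ.* p ℕ.+ k) ℕ.+ (6 ℕ.* k ℕ.+ 3)
  regroup = ℕ-Ring.solve-∀
  square-suc : ∀ k → 3 ℕ.* (k ℕ.* k) ℕ.+ (6 ℕ.* k ℕ.+ 3) ≡ 3 ℕ.* (suc k ℕ.* suc k)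
  square-suc = ℕ-Ring.solve-∀

p5≡pentagonal : ∀ n → p5 n ≡ pentagonal n
p5≡pentagonal n = trans (cong (ℕ._/ 2) numerator≡) (m*n/n≡m (pentagonal n) 2)
  where
  numerator≡ : n ℕ.* (3 ℕ.* n ℕ.∸ 1) ≡ pentagonal n ℕ.* 2
  numerator≡ = begin
    n ℕ.* (3 ℕ.* n ℕ.∸ 1)                        ≡⟨ ℕ.*-distribˡ-∸ n (3 ℕ.* n) 1 ⟩
    n ℕ.* (3 ℕ.* n) ℕ.∸ n ℕ.* 1                  ≡⟨ cong₂ ℕ._∸_ (trans (ℕ.*-comm n (3 ℕ.* n)) (ℕ.*-assoc 3 n n)) (ℕ.*-identityʳ n) ⟩
    3 ℕ.* (n ℕ.* n) ℕ.∸ n                        ≡⟨ cong (ℕ._∸ n) (2*pentagonal[n]+n≡3*n*n n) ⟨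
    2 ℕ.* pentagonal n ℕ.+ n ℕ.∸ n               ≡⟨ ℕ.m+n∸n≡m (2 ℕ.* pentagonal n) n ⟩
    2 ℕ.* pentagonal n                           ≡⟨ ℕ.*-comm 2 (pentagonal n) ⟩
    pentagonal n ℕ.* 2                           ∎

twicePentagonal : ℤ → ℤ
twicePentagonal i = + 3 * (i * i) - i

+2*p5[n]≡twicePentagonal[n] : ∀ n → + 2 * + p5 n ≡ twicePentagonal (+ n)
+2*p5[n]≡twicePentagonal[n] n = begin
  + 2 * + p5 n                    ≡⟨ cong (λ m → + 2 * + m) (p5≡pentagonal n) ⟩
  + 2 * + p                       ≡⟨ ℤ.pos-* 2 p ⟨
  + (2 ℕ.* p)                     ≡⟨ i≡i+j-j (+ (2 ℕ.* p)) (+ n) ⟩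
  + (2 ℕ.* p) + + n - + n         ≡⟨ cong (_- + n) (ℤ.pos-+ (2 ℕ.* p) n) ⟨
  + (2 ℕ.* p ℕ.+ n) - + n         ≡⟨ cong (λ m → + m - + n) (2*pentagonal[n]+n≡3*n*n n) ⟩
  + (3 ℕ.* (n ℕ.* n)) - + n       ≡⟨ cong (_- + n) (trans (ℤ.pos-* 3 (n ℕ.* n)) (cong (+ 3 *_) (ℤ.pos-* n n))) ⟩
  + 3 * (+ n * + n) - + n         ∎
  where
  p = pentagonal n
  i≡i+j-j : ∀ i j → i ≡ i + j - j
  i≡i+j-j = ℤ-Ring.solve-∀

pentagonalSum : ℤ → ℤ → ℤ → ℤ → ℤ
pentagonalSum i j k l = twicePentagonal i + twicePentagonal j + twicePentagonal k + + 2 * twicePentagonal l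

pentagonalSum-shift : ∀ n b x y z t → x + y + z ≡ + 2 * t →
  + 4 * (n + b) + + 6 * b - + 30 * (b * b) ≡ + 6 * (x * x + y * y + z * z) + + 3 * ((x + y + z) * (x + y + z)) →
  pentagonalSum (b + x) (b + y) (b + z) (b - t) ≡ + 2 * n
pentagonalSum-shift n b x y z t s≡2t equation = ℤ.*-cancelˡ-≡ (+ 2) _ _ (begin
  + 2 * pentagonalSum (b + x) (b + y) (b + z) (b - t)
    ≡⟨ expand b x y z t ⟩
  (+ 6 * (x * x + y * y + z * z) + + 3 * (s * s)) + + 30 * (b * b) - + 10 * b + c * (s - + 2 * t)
    ≡⟨ cong₂ (λ r d → r + + 30 * (b * b) - + 10 * b + c * d) (sym equation) (ℤ.i≡j⇒i-j≡0 s≡2t) ⟩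
  (+ 4 * (n + b) + + 6 * b - + 30 * (b * b)) + + 30 * (b * b) - + 10 * b + c * 0ℤ
    ≡⟨ simplify n b c ⟩
  + 2 * (+ 2 * n) ∎)
  where
  s = x + y + z
  c = + 12 * b - + 2 - + 3 * (s + + 2 * t)
  -- twicePentagonal unfolded: the ring solver does not see through definitions
  expand : ∀ b x y z t →
    + 2 * ((+ 3 * ((b + x) * (b + x)) - (b + x)) + (+ 3 * ((b + y) * (b + y)) - (b + y))
           + (+ 3 * ((b + z) * (b + z)) - (b + z)) + + 2 * (+ 3 * ((b - t) * (b - t)) - (b - t)))
    ≡ (+ 6 * (x * x + y * y + z * z) + + 3 * ((x + y + z) * (x + y + z))) + + 30 * (b * b) - + 10 * b
      + (+ 12 * b - + 2 - + 3 * (x + y + z + + 2 * t)) * (x + y + z - + 2 * t)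
  expand = ℤ-Ring.solve-∀
  simplify : ∀ n b c → (+ 4 * (n + b) + + 6 * b - + 30 * (b * b)) + + 30 * (b * b) - + 10 * b + c * 0ℤ ≡ + 2 * (+ 2 * n)
  simplify = ℤ-Ring.solve-∀

2*i≢2*j+1 : ∀ i j → + 2 * i ≢ + 2 * j + + 1
2*i≢2*j+1 i j eq = ℕ.1+n≢n (ℕ.m*n≡1⇒m≡1 2 ∣ i - j ∣ (begin
  2 ℕ.* ∣ i - j ∣            ≡⟨ ℤ.abs-* (+ 2) (i - j) ⟨
  ∣ + 2 * (i - j) ∣          ≡⟨ cong ∣_∣ (distrib i j) ⟩
  ∣ + 2 * i - + 2 * j ∣      ≡⟨ cong (λ k → ∣ k - + 2 * j ∣) eq ⟩
  ∣ + 2 * j + + 1 - + 2 * j ∣ ≡⟨ cong ∣_∣ (cancel j) ⟩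
  1                          ∎))
  where
  distrib : ∀ i j → + 2 * (i - j) ≡ + 2 * i - + 2 * j
  distrib = ℤ-Ring.solve-∀
  cancel : ∀ j → + 2 * j + + 1 - + 2 * j ≡ + 1
  cancel = ℤ-Ring.solve-∀

3*i*i-even⇒i-even : ∀ u i → + 2 * u ≡ + 3 * (i * i) → ∃[ t ] i ≡ + 2 * t
3*i*i-even⇒i-even u i eq with i %ℕ 2 | n%ℕd<d i 2 | a≡a%ℕn+[a/ℕn]*n i 2
... | 0 | _ | i≡r+2q = i /ℕ 2 , trans i≡r+2q (even (i /ℕ 2))
  where
  even : ∀ q → + 0 + q * + 2 ≡ + 2 * q
  even = ℤ-Ring.solve-∀
... | 1 | _ | i≡r+2q = ⊥-elim (2*i≢2*j+1 u (+ 6 * (q * q) + + 6 * q + + 1) (begin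
  + 2 * u                                      ≡⟨ eq ⟩
  + 3 * (i * i)                                ≡⟨ cong (λ k → + 3 * (k * k)) i≡r+2q ⟩
  + 3 * ((+ 1 + q * + 2) * (+ 1 + q * + 2))     ≡⟨ odd q ⟩
  + 2 * (+ 6 * (q * q) + + 6 * q + + 1) + + 1  ∎))
  where
  q = i /ℕ 2
  odd : ∀ q → + 3 * ((+ 1 + q * + 2) * (+ 1 + q * + 2)) ≡ + 2 * (+ 6 * (q * q) + + 6 * q + + 1) + + 1
  odd = ℤ-Ring.solve-∀
... | suc (suc _) | ℕ.s≤s (ℕ.s≤s ()) | _

x+y+z-even : ∀ n b x y z →
  + 4 * (n + b) + + 6 * b - + 30 * (b * b) ≡ + 6 * (x * x + y * y + z * z) + + 3 * ((x + y + z) * (x + y + z)) →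
  ∃[ t ] x + y + z ≡ + 2 * t
x+y+z-even n b x y z equation = 3*i*i-even⇒i-even (+ 2 * (n + b) + + 3 * b - + 15 * (b * b) - + 3 * q) s (begin
  + 2 * (+ 2 * (n + b) + + 3 * b - + 15 * (b * b) - + 3 * q) ≡⟨ halve n b q ⟩
  + 4 * (n + b) + + 6 * b - + 30 * (b * b) - + 6 * q        ≡⟨ cong (_- + 6 * q) equation ⟩
  + 6 * q + + 3 * (s * s) - + 6 * q                         ≡⟨ cancel q (+ 3 * (s * s)) ⟩
  + 3 * (s * s)                                             ∎)
  where
  s = x + y + z
  q = x * x + y * y + z * z
  halve : ∀ n b q → + 2 * (+ 2 * (n + b) + + 3 * b - + 15 * (b * b) - + 3 * q) ≡ + 4 * (n + b) + + 6 * b - + 30 * (b * b) - + 6 * q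
  halve = ℤ-Ring.solve-∀
  cancel : ∀ q r → + 6 * q + r - + 6 * q ≡ r
  cancel = ℤ-Ring.solve-∀

0≤i*i : ∀ i → 0ℤ ≤ i * i
0≤i*i (+ k)    = subst (0ℤ ≤_) (ℤ.pos-* k k) (+≤+ ℕ.z≤n)
0≤i*i -[1+ k ] = +≤+ ℕ.z≤n

k*i+j≤k*l⇒i≤l : ∀ k {i j l} .{{_ : Positive k}} → 0ℤ ≤ j → k * i + j ≤ k * l → i ≤ l
k*i+j≤k*l⇒i≤l k {i} {j} {l} 0≤j ki+j≤kl =
  ℤ.*-cancelˡ-≤-pos i l k (ℤ.≤-trans (ℤ.i≤i+j (k * i) j {{nonNegative 0≤j}}) ki+j≤kl)

squares-bounded : ∀ x y z t K → x + y + z ≡ + 2 * t →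
  + 6 * (x * x + y * y + z * z) + + 3 * ((x + y + z) * (x + y + z)) ≤ + 6 * K →
  x * x ≤ K × y * y ≤ K × z * z ≤ K × t * t ≤ K
squares-bounded x y z t K s≡2t ≤6K =
    bounded x y z t t (split-x x y z t)
  , bounded y x z t t (split-y x y z t)
  , bounded z x y t t (split-z x y z t)
  , bounded t x y z t (split-t x y z t)
  where
  total≤6K : + 6 * (x * x + y * y + z * z) + + 3 * ((+ 2 * t) * (+ 2 * t)) ≤ + 6 * K
  total≤6K = subst (λ s → + 6 * (x * x + y * y + z * z) + + 3 * (s * s) ≤ + 6 * K) s≡2t ≤6K
  bounded : ∀ w a b c d →
    + 6 * (x * x + y * y + z * z) + + 3 * ((+ 2 * t) * (+ 2 * t)) ≡ + 6 * (w * w) + + 6 * (a * a + b * b + c * c + d * d) →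
    w * w ≤ K
  bounded w a b c d split = k*i+j≤k*l⇒i≤l (+ 6)
    (ℤ.*-monoˡ-≤-nonNeg (+ 6) (ℤ.+-mono-≤ (ℤ.+-mono-≤ (ℤ.+-mono-≤ (0≤i*i a) (0≤i*i b)) (0≤i*i c)) (0≤i*i d)))
    (subst (_≤ + 6 * K) split total≤6K)
  split-x : ∀ x y z t → + 6 * (x * x + y * y + z * z) + + 3 * ((+ 2 * t) * (+ 2 * t)) ≡ + 6 * (x * x) + + 6 * (y * y + z * z + t * t + t * t)
  split-x = ℤ-Ring.solve-∀
  split-y : ∀ x y z t → + 6 * (x * x + y * y + z * z) + + 3 * ((+ 2 * t) * (+ 2 * t)) ≡ + 6 * (y * y) + + 6 * (x * x + z * z + t * t + t * t)
  split-y = ℤ-Ring.solve-∀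
  split-z : ∀ x y z t → + 6 * (x * x + y * y + z * z) + + 3 * ((+ 2 * t) * (+ 2 * t)) ≡ + 6 * (z * z) + + 6 * (x * x + y * y + t * t + t * t)
  split-z = ℤ-Ring.solve-∀
  split-t : ∀ x y z t → + 6 * (x * x + y * y + z * z) + + 3 * ((+ 2 * t) * (+ 2 * t)) ≡ + 6 * (t * t) + + 6 * (x * x + y * y + z * z + t * t)
  split-t = ℤ-Ring.solve-∀

i*i≤n*n⇒0≤n+i : ∀ n i → i * i ≤ + n * + n → 0ℤ ≤ + n + i
i*i≤n*n⇒0≤n+i n (+ k)    _ = +≤+ ℕ.z≤n
i*i≤n*n⇒0≤n+i n -[1+ k ] i*i≤n*n with suc k ℕ.≤? n
... | yes k<n = subst (0ℤ ≤_) (sym (ℤ.⊖-≥ k<n)) (+≤+ ℕ.z≤n)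
... | no  k≮n = ⊥-elim (ℕ.<⇒≱ (ℕ.*-mono-< n<1+k n<1+k)
                                (ℤ.drop‿+≤+ (subst (-[1+ k ] * -[1+ k ] ≤_) (sym (ℤ.pos-* n n)) i*i≤n*n)))
  where
  n<1+k : n ℕ.< suc k
  n<1+k = ℕ.≰⇒> k≮n

i*i≤n*n⇒0≤n-i : ∀ n i → i * i ≤ + n * + n → 0ℤ ≤ + n - i
i*i≤n*n⇒0≤n-i n i i*i≤n*n = i*i≤n*n⇒0≤n+i n (- i) (subst (_≤ + n * + n) (neg-square i) i*i≤n*n)
  where
  neg-square : ∀ i → i * i ≡ (- i) * (- i)
  neg-square = ℤ-Ring.solve-∀

sum-cast : ∀ p q r s → + (p ℕ.+ q ℕ.+ r ℕ.+ 2 ℕ.* s) ≡ + p + + q + + r + + 2 * + s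
sum-cast p q r s = begin
  + (p ℕ.+ q ℕ.+ r ℕ.+ 2 ℕ.* s)   ≡⟨ ℤ.pos-+ (p ℕ.+ q ℕ.+ r) (2 ℕ.* s) ⟩
  + (p ℕ.+ q ℕ.+ r) + + (2 ℕ.* s) ≡⟨ cong₂ _+_ (trans (ℤ.pos-+ (p ℕ.+ q) r) (cong (_+ + r) (ℤ.pos-+ p q))) (ℤ.pos-* 2 s) ⟩
  + p + + q + + r + + 2 * + s     ∎

pentagonal-representation : ∀ {n a b c e i j k l} → + a ≡ i → + b ≡ j → + c ≡ k → + e ≡ l →
  pentagonalSum i j k l ≡ + 2 * + n → n ≡ p5 a ℕ.+ p5 b ℕ.+ p5 c ℕ.+ 2 ℕ.* p5 e
pentagonal-representation {n} {a} {b} {c} {e} refl refl refl refl sum≡2n =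
  sym (ℤ.+-injective (ℤ.*-cancelˡ-≡ (+ 2) _ _ (begin
    + 2 * + (p5 a ℕ.+ p5 b ℕ.+ p5 c ℕ.+ 2 ℕ.* p5 e)
      ≡⟨ cong (+ 2 *_) (sum-cast (p5 a) (p5 b) (p5 c) (p5 e)) ⟩
    + 2 * (+ p5 a + + p5 b + + p5 c + + 2 * + p5 e)
      ≡⟨ distrib (+ p5 a) (+ p5 b) (+ p5 c) (+ p5 e) ⟩
    + 2 * + p5 a + + 2 * + p5 b + + 2 * + p5 c + + 2 * (+ 2 * + p5 e)
      ≡⟨ cong₂ _+_ (cong₂ _+_ (cong₂ _+_ (twice a) (twice b)) (twice c)) (cong (+ 2 *_) (twice e)) ⟩
    pentagonalSum (+ a) (+ b) (+ c) (+ e)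
      ≡⟨ sum≡2n ⟩
    + 2 * + n ∎)))
  where
  twice = +2*p5[n]≡twicePentagonal[n]
  distrib : ∀ p q r s → + 2 * (p + q + r + + 2 * s) ≡ + 2 * p + + 2 * q + + 2 * r + + 2 * (+ 2 * s)
  distrib = ℤ-Ring.solve-∀

lemma2p2 : (n : ℕ) →
  (Σ ℕ λ B → Σ ℤ λ x → Σ ℤ λ y → Σ ℤ λ z →
    (3 ∣ Data.Nat._+_ n B) ×
    ((+ 4) * (+ n + + B) + (+ 6) * (+ B) - (+ 30) * (+ B * + B)
       ≡ (+ 6) * (x * x + y * y + z * z) + (+ 3) * ((x + y + z) * (x + y + z))) ×
    ((+ 6) * (x * x + y * y + z * z) + (+ 3) * ((x + y + z) * (x + y + z))
       ≤ (+ 6) * (+ B * + B))) →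
  ∃[ x₀ ] ∃[ y₀ ] ∃[ z₀ ] ∃[ w₀ ]
    (n ≡ Data.Nat._+_ (Data.Nat._+_ (Data.Nat._+_ (p5 x₀) (p5 y₀)) (p5 z₀)) (Data.Nat._*_ 2 (p5 w₀)))
lemma2p2 n (B , x , y , z , _ , equation , bound)
  with t , s≡2t ← x+y+z-even (+ n) (+ B) x y z equation
  with x≤B , y≤B , z≤B , t≤B ← squares-bounded x y z t (+ B * + B) s≡2t bound
  = ∣ + B + x ∣ , ∣ + B + y ∣ , ∣ + B + z ∣ , ∣ + B - t ∣
  , pentagonal-representation
      (ℤ.0≤i⇒+∣i∣≡i (i*i≤n*n⇒0≤n+i B x x≤B)) (ℤ.0≤i⇒+∣i∣≡i (i*i≤n*n⇒0≤n+i B y y≤B))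
      (ℤ.0≤i⇒+∣i∣≡i (i*i≤n*n⇒0≤n+i B z z≤B)) (ℤ.0≤i⇒+∣i∣≡i (i*i≤n*n⇒0≤n-i B t t≤B))
      (pentagonalSum-shift (+ n) (+ B) x y z t s≡2t equation)
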